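{- Let $g\colon\mathbb{N}\to\mathbb{N}$ be any non-decreasing unbounded function. For each $k\in\mathbb{N}$, $\phi_g$ restricts to a bijection from $A_k$ to $B_k$, and the restriction of $\psi_g$ to $B_k$ is its inverse.
   Context: $\mathbb{N}$ denotes the non-negative integers. $g$ is non-decreasing if $x\le y$ implies $g(x)\le g(y)$, and unbounded if for every $y$ there is $x$ with $g(x)\ge y$. Define $g^+(y)$ to be the smallest $x\in\mathbb{N}$ with $g(x)\ge y$. The step points of $g$ are the elements of the range of $g^+$, listed increasingly as $s_0<s_1<s_2<\cdots$ (so $s_0=0$). For $k\in\mathbb{N}$ let $A_k=\{(x,y)\in\mathbb{N}^2 : x<s_{k+1}\text{ and } y\le g(s_k)\}$ and $B_k=\{0,1,\ldots,s_{k+1}(g(s_k)+1)-1\}$. Define $\phi_g\colon\mathbb{N}^2\to\mathbb{N}$ by $\phi_g(x,y)=y\cdot g^+(y)+x$ if $y>g(x)$, and $\phi_g(x,y)=x(g(x)+1)+y$ otherwise. Define $\psi_g\colon\mathbb{N}\to\mathbb{N}^2$: for $z\in\mathbb{N}$ let $m$ be the smallest non-negative integer with $z\in B_m$; then $\psi_g(z)=(z\bmod s_m,\ \lfloor z/s_m\rfloor)$ if $z<s_m(g(s_m)+1)$, and $\psi_g(z)=(\lfloor z/(g(s_m)+1)\rfloor,\ z\bmod(g(s_m)+1))$ otherwise. -}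

module Defs where

open import Data.Nat using (ℕ; zero; suc; _+_; _*_; _≤_; _<_; _≥_; _<ᵇ_; _≤ᵇ_; _/_; _%_)
open import Data.Bool using (Bool; true; false; if_then_else_)
open import Data.Product using (_×_; _,_; Σ; ∃)
open import Relation.Binary.PropositionalEquality using (_≡_)

NonDecreasing : (ℕ → ℕ) → Set
NonDecreasing g = ∀ {x y} → x ≤ y → g x ≤ g y

Unbounded : (ℕ → ℕ) → Set
Unbounded g = ∀ y → ∃ λ x → g x ≥ y

IsGPlus : (ℕ → ℕ) → (ℕ → ℕ) → Set
IsGPlus g gp = ∀ y → (g (gp y) ≥ y) × (∀ x → x < gp y → g x < y)

IsStepPoints : (ℕ → ℕ) → (ℕ → ℕ) → Set
IsStepPoints gp s =
  (∀ k → s k < s (suc k)) ×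
  (∀ k → ∃ λ y → s k ≡ gp y) ×
  (∀ y → ∃ λ k → gp y ≡ s k)

-- total division / remainder (divisor 0 never occurs where used)
div' : ℕ → ℕ → ℕ
div' z zero = zero
div' z (suc n) = z / suc n

mod' : ℕ → ℕ → ℕ
mod' z zero = z
mod' z (suc n) = z % suc n

InA : (g s : ℕ → ℕ) → ℕ → ℕ × ℕ → Set
InA g s k (x , y) = (x < s (suc k)) × (y ≤ g (s k))

InB : (g s : ℕ → ℕ) → ℕ → ℕ → Set
InB g s k z = z < s (suc k) * (g (s k) + 1)

phi : (g gp : ℕ → ℕ) → ℕ × ℕ → ℕ
phi g gp (x , y) = if g x <ᵇ y then y * gp y + x else x * (g x + 1) + y

searchFrom : (ℕ → Bool) → ℕ → ℕ → ℕ
searchFrom p zero i = i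
searchFrom p (suc fuel) i = if p i then i else searchFrom p fuel (suc i)

-- the smallest m with z ∈ B_m  (such m is ≤ z, since s (suc z) ≥ suc z)
minB : (g s : ℕ → ℕ) → ℕ → ℕ
minB g s z = searchFrom (λ m → z <ᵇ s (suc m) * (g (s m) + 1)) z 0

psi : (g s : ℕ → ℕ) → ℕ → ℕ × ℕ
psi g s z =
  let m = minB g s z in
  if z <ᵇ s m * (g (s m) + 1)
  then (mod' z (s m) , div' z (s m))
  else (div' z (g (s m) + 1) , mod' z (g (s m) + 1))

module Submission where

-- Write S = s (suc j) and w m = g (s m) + 1.  Because g is constant, equal to
-- g (s m), on each step [s m, s (suc m)) and jumps exactly at the step points,
-- the rectangle A_k is the disjoint union of two kinds of pieces:
--   * vertical pieces   V j (suc j ≤ k): x < S and g (s j) < y ≤ g S,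
--     where phi (x , y) = y * S + x, and
--   * horizontal pieces H m (m ≤ k): s m ≤ x < s (suc m) and y ≤ g (s m),
--     where phi (x , y) = x * w m + y.
-- Likewise B_k = [0, s (suc k) * w k) is the disjoint union of the intervals
--   [s (suc j) * w j, S * w (suc j))   and   [s m * w m, s (suc m) * w m),
-- and on each of them psi computes the quotient and remainder of the matching
-- mixed-radix representation.  So phi and psi are mutually inverse on each
-- piece/interval pair by uniqueness of division with remainder.

open import Defs
open import Data.Nat using (ℕ; zero; suc; _+_; _*_; _≤_; _<_; _<ᵇ_; _/_; _%_; z≤n; s≤s; _<?_; _≤?_)
open import Data.Nat.Properties
open import Data.Nat.DivMod
open import Data.Nat.Divisibility using (n∣m*n)
open import Data.Bool using (Bool; true; false; T)
open import Data.Sum using (_⊎_; inj₁; inj₂)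
open import Data.Product using (_×_; _,_; ∃; proj₁; proj₂)
open import Data.Empty using (⊥-elim)
open import Relation.Nullary using (¬_; yes; no)
open import Relation.Binary.PropositionalEquality

<ᵇ-true : ∀ {a b} → a < b → (a <ᵇ b) ≡ true
<ᵇ-true {a} {b} a<b with a <ᵇ b | <⇒<ᵇ a<b
... | true | _ = refl

<ᵇ-false : ∀ {a b} → ¬ a < b → (a <ᵇ b) ≡ false
<ᵇ-false {a} {b} a≮b with a <ᵇ b in eq
... | false = refl
... | true = ⊥-elim (a≮b (<ᵇ⇒< a b (subst T (sym eq) _)))

≤⇒<+1 : ∀ {a b} → a ≤ b → a < b + 1
≤⇒<+1 {b = b} a≤b = ≤-<-trans a≤b (m<m+n b (s≤s z≤n))

<+1⇒≤ : ∀ {a b} → a < b + 1 → a ≤ b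
<+1⇒≤ {a} {b} a<b+1 = ≤-pred (subst (a <_) (+-comm b 1) a<b+1)

<⇒+1≤ : ∀ {a b} → a < b → a + 1 ≤ b
<⇒+1≤ {a} {b} = subst (_≤ b) (+-comm 1 a)

+1≤⇒< : ∀ {a b} → a + 1 ≤ b → a < b
+1≤⇒< {a} {b} = subst (_≤ b) (+-comm a 1)

searchFrom-first : ∀ (p : ℕ → Bool) fuel i m → i ≤ m → m ≤ i + fuel → p m ≡ true →
  (∀ j → i ≤ j → j < m → p j ≡ false) → searchFrom p fuel i ≡ m
searchFrom-first p zero i m i≤m m≤i+0 _ _ =
  ≤-antisym i≤m (subst (m ≤_) (+-identityʳ i) m≤i+0)
searchFrom-first p (suc fuel) i m i≤m m≤i+fuel pm earlier with m≤n⇒m<n∨m≡n i≤m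
... | inj₂ refl rewrite pm = refl
... | inj₁ i<m rewrite earlier i ≤-refl i<m =
  searchFrom-first p fuel (suc i) m i<m (subst (m ≤_) (+-suc i fuel) m≤i+fuel) pm
    (λ j i<j j<m → earlier j (<⇒≤ i<j) j<m)

digits-below : ∀ {q r d} b → r < d → q < b → q * d + r < b * d
digits-below {q} {r} {d} b r<d q<b = begin-strict
  q * d + r  <⟨ +-monoʳ-< (q * d) r<d ⟩
  q * d + d  ≡⟨ +-comm (q * d) d ⟩
  suc q * d  ≤⟨ *-monoˡ-≤ d q<b ⟩
  b * d      ∎
  where open ≤-Reasoning

digits-above : ∀ {q r d} a → a ≤ q → a * d ≤ q * d + r
digits-above {q} {r} {d} a a≤q = ≤-trans (*-monoˡ-≤ d a≤q) (m≤m+n (q * d) r)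

div'-digits : ∀ d q r → r < d → div' (q * d + r) d ≡ q
div'-digits d@(suc _) q r r<d = begin
  (q * d + r) / d     ≡⟨ +-distrib-/ (q * d) r no-carry ⟩
  q * d / d + r / d   ≡⟨ cong₂ _+_ (m*n/n≡m q d) (m<n⇒m/n≡0 r<d) ⟩
  q + 0               ≡⟨ +-identityʳ q ⟩
  q                   ∎
  where
  open ≡-Reasoning
  no-carry : (q * d) % d + r % d < d
  no-carry = subst (_< d) (sym (cong₂ _+_ (m*n%n≡0 q d) (m<n⇒m%n≡m r<d))) r<d

mod'-digits : ∀ d q r → r < d → mod' (q * d + r) d ≡ r
mod'-digits d@(suc _) q r r<d = trans (%-remove-+ˡ r (n∣m*n q)) (m<n⇒m%n≡m r<d)

div'-mod'-recompose : ∀ z d → 0 < d → div' z d * d + mod' z d ≡ z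
div'-mod'-recompose z d@(suc _) _ = trans (+-comm (z / d * d) (z % d)) (sym (m≡m%n+[m/n]*n z d))

mod'-below : ∀ z d → 0 < d → mod' z d < d
mod'-below z d@(suc _) _ = m%n<n z d

div'-below : ∀ z d b → 0 < d → z < b * d → div' z d < b
div'-below z d@(suc _) b _ z<bd = m<n*o⇒m/o<n {z} {b} {d} z<bd

div'-above : ∀ z d a → 0 < d → a * d ≤ z → a ≤ div' z d
div'-above z d@(suc _) a _ ad≤z = subst (_≤ z / d) (m*n/n≡m a d) (/-monoˡ-≤ d ad≤z)

module StrictlyIncreasing (s : ℕ → ℕ) (increasing : ∀ k → s k < s (suc k)) where

  s-mono-< : ∀ {i j} → i < j → s i < s j
  s-mono-< {i} {suc j} (s≤s i≤j) with m≤n⇒m<n∨m≡n i≤j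
  ... | inj₁ i<j = <-trans (s-mono-< i<j) (increasing j)
  ... | inj₂ refl = increasing i

  s-mono : ∀ {i j} → i ≤ j → s i ≤ s j
  s-mono i≤j with m≤n⇒m<n∨m≡n i≤j
  ... | inj₁ i<j = <⇒≤ (s-mono-< i<j)
  ... | inj₂ refl = ≤-refl

  n≤s : ∀ n → n ≤ s n
  n≤s zero = z≤n
  n≤s (suc n) = ≤-trans (s≤s (n≤s n)) (increasing n)

  step-containing : ∀ k x → s 0 ≤ x → x < s (suc k) →
    ∃ λ m → m ≤ k × s m ≤ x × x < s (suc m)
  step-containing zero x s0≤x x<s1 = 0 , ≤-refl , s0≤x , x<s1
  step-containing (suc k) x s0≤x x<s with s (suc k) ≤? x
  ... | yes sk≤x = suc k , ≤-refl , sk≤x , x<s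
  ... | no sk≰x =
    let (m , m≤k , sm≤x , x<sm) = step-containing k x s0≤x (≰⇒> sk≰x)
    in m , m≤n⇒m≤1+n m≤k , sm≤x , x<sm

module StepPoints (g : ℕ → ℕ) (mono : NonDecreasing g)
                  (gp : ℕ → ℕ) (gp-least : IsGPlus g gp)
                  (s : ℕ → ℕ) (steps : IsStepPoints gp s) where

  s-step : ∀ k → s k < s (suc k)
  s-step = proj₁ steps

  open StrictlyIncreasing s s-step

  gp-is-step : ∀ y → ∃ λ k → gp y ≡ s k
  gp-is-step = proj₂ (proj₂ steps)

  gp-reaches : ∀ y → y ≤ g (gp y)
  gp-reaches y = proj₁ (gp-least y)

  below-gp : ∀ y x → x < gp y → g x < y
  below-gp y = proj₂ (gp-least y)

  G : ℕ → ℕ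
  G j = g (s j)

  w : ℕ → ℕ
  w m = G m + 1

  0<w : ∀ m → 0 < w m
  0<w m = ≤⇒<+1 z≤n

  G-mono : ∀ {i j} → i ≤ j → G i ≤ G j
  G-mono i≤j = mono (s-mono i≤j)

  -- The first step point is 0, since g⁺ 0 = 0 is a step point.
  s0≡0 : s 0 ≡ 0
  s0≡0 with gp-is-step 0
  ... | k , gp0≡sk = n≤0⇒n≡0 (≤-trans (s-mono z≤n) (subst (_≤ 0) gp0≡sk gp0≤0))
    where
    gp0≤0 : gp 0 ≤ 0
    gp0≤0 = ≮⇒≥ (λ 0<gp0 → n≮0 (below-gp 0 0 0<gp0))

  gp-successor-step : ∀ {y} → g 0 < y → ∃ λ j → gp y ≡ s (suc j)
  gp-successor-step {y} g0<y with gp-is-step y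
  ... | zero , gpy≡s0 =
    ⊥-elim (<⇒≱ g0<y (subst (λ t → y ≤ g t) (trans gpy≡s0 s0≡0) (gp-reaches y)))
  ... | suc j , gpy≡ = j , gpy≡

  jump-at-step : ∀ {y j} → gp y ≡ s (suc j) → G j < y × y ≤ G (suc j)
  jump-at-step {y} {j} gpy≡ =
    below-gp y (s j) (subst (s j <_) (sym gpy≡) (s-step j)) ,
    subst (λ t → y ≤ g t) gpy≡ (gp-reaches y)

  gp-at-jump : ∀ {y j} → G j < y → y ≤ G (suc j) → gp y ≡ s (suc j)
  gp-at-jump {y} {j} Gj<y y≤GSj with gp-is-step y
  ... | i , gpy≡si = ≤-antisym gp≤ gp≥
    where
    gp≤ : gp y ≤ s (suc j)
    gp≤ = ≮⇒≥ (λ gp>S → <⇒≱ (below-gp y (s (suc j)) gp>S) y≤GSj)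
    j<i : j < i
    j<i = ≰⇒> (λ i≤j → <⇒≱ Gj<y
            (≤-trans (subst (λ t → y ≤ g t) gpy≡si (gp-reaches y)) (G-mono i≤j)))
    gp≥ : s (suc j) ≤ gp y
    gp≥ = subst (s (suc j) ≤_) (sym gpy≡si) (s-mono j<i)

  g-on-step : ∀ {j x} → s j ≤ x → x < s (suc j) → g x ≡ G j
  g-on-step {j} {x} sj≤x x<S = ≤-antisym gx≤Gj (mono sj≤x)
    where
    gx≤Gj : g x ≤ G j
    gx≤Gj with gp-successor-step {suc (G j)} (s≤s (mono z≤n))
    ... | i , gp≡ = ≤-pred (below-gp (suc (G j)) x (<-≤-trans x<S S≤gp))
      where
      j≤i : j ≤ i
      j≤i = ≮⇒≥ (λ i<j → <⇒≱ (proj₂ (jump-at-step gp≡)) (G-mono i<j))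
      S≤gp : s (suc j) ≤ gp (suc (G j))
      S≤gp = subst (s (suc j) ≤_) (sym gp≡) (s-mono (s≤s j≤i))

  g-below-step : ∀ {j x} → x < s (suc j) → g x ≤ G j
  g-below-step {j} {x} x<S with s j ≤? x
  ... | yes sj≤x = ≤-reflexive (g-on-step sj≤x x<S)
  ... | no sj≰x = mono (<⇒≤ (≰⇒> sj≰x))

  -- Block m of the target is B_m = [0, bnd m); psi splits the part of it
  -- beyond the previous block at mid m.
  bnd : ℕ → ℕ
  bnd m = s (suc m) * w m

  mid : ℕ → ℕ
  mid m = s m * w m

  bnd-mono : ∀ {i j} → i ≤ j → bnd i ≤ bnd j
  bnd-mono i≤j = *-mono-≤ (s-mono (s≤s i≤j)) (+-monoˡ-≤ 1 (G-mono i≤j))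

  bnd≤mid : ∀ {i j} → i < j → bnd i ≤ mid j
  bnd≤mid i<j = *-mono-≤ (s-mono i<j) (+-monoˡ-≤ 1 (G-mono (<⇒≤ i<j)))

  mid≤bnd : ∀ m → mid m ≤ bnd m
  mid≤bnd m = *-monoˡ-≤ (w m) (<⇒≤ (s-step m))

  VPiece : ℕ → ℕ × ℕ → Set
  VPiece j (x , y) = x < s (suc j) × G j < y × y ≤ G (suc j)

  HPiece : ℕ → ℕ × ℕ → Set
  HPiece m (x , y) = s m ≤ x × x < s (suc m) × y ≤ G m

  VZone : ℕ → ℕ → Set
  VZone j z = bnd j ≤ z × z < mid (suc j)

  HZone : ℕ → ℕ → Set
  HZone m z = mid m ≤ z × z < bnd m

  A-split : ∀ k x y → InA g s k (x , y) →
    (∃ λ j → suc j ≤ k × VPiece j (x , y)) ⊎ (∃ λ m → m ≤ k × HPiece m (x , y))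
  A-split k x y (x<s , y≤Gk) with g x <? y
  ... | yes gx<y with gp-successor-step (≤-<-trans (mono z≤n) gx<y)
  ...   | j , gp≡ = inj₁ (j , sj≤k , x<S , Gj<y , y≤GSj)
    where
    Gj<y : G j < y
    Gj<y = proj₁ (jump-at-step gp≡)
    y≤GSj : y ≤ G (suc j)
    y≤GSj = proj₂ (jump-at-step gp≡)
    x<S : x < s (suc j)
    x<S = ≰⇒> (λ S≤x → <⇒≱ gx<y (≤-trans y≤GSj (mono S≤x)))
    sj≤k : suc j ≤ k
    sj≤k = ≮⇒≥ (λ k<sj → <⇒≱ Gj<y (≤-trans y≤Gk (G-mono (≤-pred k<sj))))
  A-split k x y (x<s , y≤Gk) | no gx≮y
    with step-containing k x (subst (_≤ x) (sym s0≡0) z≤n) x<s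
  ... | m , m≤k , sm≤x , x<sm =
    inj₂ (m , m≤k , sm≤x , x<sm , subst (y ≤_) (g-on-step sm≤x x<sm) (≮⇒≥ gx≮y))

  VPiece-in-A : ∀ {k j} p → suc j ≤ k → VPiece j p → InA g s k p
  VPiece-in-A (x , y) sj≤k (x<S , _ , y≤GSj) =
    <-≤-trans x<S (s-mono (m≤n⇒m≤1+n sj≤k)) , ≤-trans y≤GSj (G-mono sj≤k)

  HPiece-in-A : ∀ {k m} p → m ≤ k → HPiece m p → InA g s k p
  HPiece-in-A (x , y) m≤k (_ , x<sm , y≤Gm) =
    <-≤-trans x<sm (s-mono (s≤s m≤k)) , ≤-trans y≤Gm (G-mono m≤k)

  B-split : ∀ k z → InB g s k z →
    (∃ λ j → suc j ≤ k × VZone j z) ⊎ (∃ λ m → m ≤ k × HZone m z)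
  B-split zero z z<bnd = inj₂ (0 , ≤-refl , mid0≤z , z<bnd)
    where
    mid0≤z : mid 0 ≤ z
    mid0≤z = subst (_≤ z) (sym (cong (λ t → t * (g t + 1)) s0≡0)) z≤n
  B-split (suc k) z z<bnd with z <? bnd k
  ... | yes z<bndk with B-split k z z<bndk
  ...   | inj₁ (j , sj≤k , zone) = inj₁ (j , m≤n⇒m≤1+n sj≤k , zone)
  ...   | inj₂ (m , m≤k , zone) = inj₂ (m , m≤n⇒m≤1+n m≤k , zone)
  B-split (suc k) z z<bnd | no z≮bndk with z <? mid (suc k)
  ... | yes z<mid = inj₁ (k , ≤-refl , ≮⇒≥ z≮bndk , z<mid)
  ... | no z≮mid = inj₂ (suc k , ≤-refl , ≮⇒≥ z≮mid , z<bnd)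

  VZone-in-B : ∀ {k j z} → suc j ≤ k → VZone j z → InB g s k z
  VZone-in-B {j = j} sj≤k (_ , z<mid) =
    <-≤-trans z<mid (≤-trans (mid≤bnd (suc j)) (bnd-mono sj≤k))

  HZone-in-B : ∀ {k m z} → m ≤ k → HZone m z → InB g s k z
  HZone-in-B m≤k (_ , z<bnd) = <-≤-trans z<bnd (bnd-mono m≤k)

  minB-first : ∀ {m z} → z < bnd m → (∀ i → i < m → bnd i ≤ z) → minB g s z ≡ m
  minB-first {m} {z} z<bnd earlier =
    searchFrom-first (λ i → z <ᵇ bnd i) z 0 m z≤n (m≤z m earlier) (<ᵇ-true z<bnd)
      (λ i _ i<m → <ᵇ-false (≤⇒≯ (earlier i i<m)))
    where
    -- the search range [0, z] is long enough, as block j already has bnd j ≥ j + 1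
    m≤z : ∀ m → (∀ i → i < m → bnd i ≤ z) → m ≤ z
    m≤z zero _ = z≤n
    m≤z (suc j) earlier' = begin
      suc j               ≤⟨ n≤s (suc j) ⟩
      s (suc j)           ≡⟨ *-identityʳ (s (suc j)) ⟨
      s (suc j) * 1       ≤⟨ *-monoʳ-≤ (s (suc j)) (0<w j) ⟩
      bnd j               ≤⟨ earlier' j ≤-refl ⟩
      z                   ∎
      where open ≤-Reasoning

  VZone-first : ∀ {j z} → VZone j z → minB g s z ≡ suc j
  VZone-first {j} (bnd≤z , z<mid) =
    minB-first (<-≤-trans z<mid (mid≤bnd (suc j)))
      (λ i i<sj → ≤-trans (bnd-mono (≤-pred i<sj)) bnd≤z)

  HZone-first : ∀ {m z} → HZone m z → minB g s z ≡ m
  HZone-first (mid≤z , z<bnd) =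
    minB-first z<bnd (λ i i<m → ≤-trans (bnd≤mid i<m) mid≤z)

  phi-above : ∀ {x y} → g x < y → phi g gp (x , y) ≡ y * gp y + x
  phi-above gx<y rewrite <ᵇ-true gx<y = refl

  phi-below : ∀ {x y} → y ≤ g x → phi g gp (x , y) ≡ x * (g x + 1) + y
  phi-below y≤gx rewrite <ᵇ-false (≤⇒≯ y≤gx) = refl

  psi-on-VZone : ∀ {j z} → VZone j z →
    psi g s z ≡ (mod' z (s (suc j)) , div' z (s (suc j)))
  psi-on-VZone zone@(_ , z<mid) rewrite VZone-first zone | <ᵇ-true z<mid = refl

  psi-on-HZone : ∀ {m z} → HZone m z → psi g s z ≡ (div' z (w m) , mod' z (w m))
  psi-on-HZone zone@(mid≤z , _) rewrite HZone-first zone | <ᵇ-false (≤⇒≯ mid≤z) = refl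

  phi-on-VPiece : ∀ {j x y} → VPiece j (x , y) → phi g gp (x , y) ≡ y * s (suc j) + x
  phi-on-VPiece {j} {x} {y} (x<S , Gj<y , y≤GSj) =
    trans (phi-above (≤-<-trans (g-below-step x<S) Gj<y))
          (cong (λ t → y * t + x) (gp-at-jump Gj<y y≤GSj))

  phi-on-HPiece : ∀ {m x y} → HPiece m (x , y) → phi g gp (x , y) ≡ x * w m + y
  phi-on-HPiece {m} {x} {y} (sm≤x , x<sm , y≤Gm) =
    trans (phi-below (subst (y ≤_) (sym gx≡Gm) y≤Gm)) (cong (λ t → x * (t + 1) + y) gx≡Gm)
    where
    gx≡Gm : g x ≡ G m
    gx≡Gm = g-on-step sm≤x x<sm

  VPiece⇒VZone : ∀ {j x y} → VPiece j (x , y) → VZone j (y * s (suc j) + x)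
  VPiece⇒VZone {j} {x} {y} (x<S , Gj<y , y≤GSj) =
    subst (_≤ z) (*-comm (w j) S) (digits-above (w j) (<⇒+1≤ Gj<y)) ,
    subst (z <_) (*-comm (w (suc j)) S) (digits-below (w (suc j)) x<S (≤⇒<+1 y≤GSj))
    where
    S = s (suc j)
    z = y * S + x

  VZone⇒VPiece : ∀ {j z} → VZone j z → VPiece j (mod' z (s (suc j)) , div' z (s (suc j)))
  VZone⇒VPiece {j} {z} (bnd≤z , z<mid) =
    mod'-below z S 0<S ,
    +1≤⇒< (div'-above z S (w j) 0<S (subst (_≤ z) (*-comm S (w j)) bnd≤z)) ,
    <+1⇒≤ (div'-below z S (w (suc j)) 0<S (subst (z <_) (*-comm S (w (suc j))) z<mid))
    where
    S = s (suc j)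
    0<S : 0 < S
    0<S = ≤-<-trans z≤n (s-step j)

  HPiece⇒HZone : ∀ {m x y} → HPiece m (x , y) → HZone m (x * w m + y)
  HPiece⇒HZone {m} (sm≤x , x<sm , y≤Gm) =
    digits-above (s m) sm≤x , digits-below (s (suc m)) (≤⇒<+1 y≤Gm) x<sm

  HZone⇒HPiece : ∀ {m z} → HZone m z → HPiece m (div' z (w m) , mod' z (w m))
  HZone⇒HPiece {m} {z} (mid≤z , z<bnd) =
    div'-above z (w m) (s m) (0<w m) mid≤z ,
    div'-below z (w m) (s (suc m)) (0<w m) z<bnd ,
    <+1⇒≤ (mod'-below z (w m) (0<w m))

  vertical-forward : ∀ {j x y} → VPiece j (x , y) →
    VZone j (phi g gp (x , y)) × psi g s (phi g gp (x , y)) ≡ (x , y)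
  vertical-forward {j} {x} {y} piece@(x<S , _ , _) rewrite phi-on-VPiece piece =
    zone , (begin
      psi g s z                    ≡⟨ psi-on-VZone zone ⟩
      (mod' z S , div' z S)        ≡⟨ cong₂ _,_ (mod'-digits S y x x<S) (div'-digits S y x x<S) ⟩
      (x , y)                      ∎)
    where
    open ≡-Reasoning
    S = s (suc j)
    z = y * S + x
    zone : VZone j z
    zone = VPiece⇒VZone piece

  vertical-backward : ∀ {j z} → VZone j z →
    VPiece j (psi g s z) × phi g gp (psi g s z) ≡ z
  vertical-backward {j} {z} zone rewrite psi-on-VZone zone =
    piece , trans (phi-on-VPiece piece) (div'-mod'-recompose z S (≤-<-trans z≤n (s-step j)))
    where
    S = s (suc j)
    piece : VPiece j (mod' z S , div' z S)
    piece = VZone⇒VPiece zone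

  horizontal-forward : ∀ {m x y} → HPiece m (x , y) →
    HZone m (phi g gp (x , y)) × psi g s (phi g gp (x , y)) ≡ (x , y)
  horizontal-forward {m} {x} {y} piece@(_ , _ , y≤Gm) rewrite phi-on-HPiece piece =
    zone , (begin
      psi g s z                      ≡⟨ psi-on-HZone zone ⟩
      (div' z (w m) , mod' z (w m))  ≡⟨ cong₂ _,_ (div'-digits (w m) x y y<w) (mod'-digits (w m) x y y<w) ⟩
      (x , y)                        ∎)
    where
    open ≡-Reasoning
    z = x * w m + y
    y<w : y < w m
    y<w = ≤⇒<+1 y≤Gm
    zone : HZone m z
    zone = HPiece⇒HZone piece

  horizontal-backward : ∀ {m z} → HZone m z →
    HPiece m (psi g s z) × phi g gp (psi g s z) ≡ z
  horizontal-backward {m} {z} zone rewrite psi-on-HZone zone =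
    piece , trans (phi-on-HPiece piece) (div'-mod'-recompose z (w m) (0<w m))
    where
    piece : HPiece m (div' z (w m) , mod' z (w m))
    piece = HZone⇒HPiece zone

  phi-on-A : ∀ k x y → InA g s k (x , y) →
    InB g s k (phi g gp (x , y)) × psi g s (phi g gp (x , y)) ≡ (x , y)
  phi-on-A k x y xy∈A with A-split k x y xy∈A
  ... | inj₁ (j , sj≤k , piece) =
    let (zone , inverse) = vertical-forward piece in VZone-in-B sj≤k zone , inverse
  ... | inj₂ (m , m≤k , piece) =
    let (zone , inverse) = horizontal-forward piece in HZone-in-B m≤k zone , inverse

  psi-on-B : ∀ k z → InB g s k z → InA g s k (psi g s z) × phi g gp (psi g s z) ≡ z
  psi-on-B k z z∈B with B-split k z z∈B
  ... | inj₁ (j , sj≤k , zone) =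
    let (piece , inverse) = vertical-backward zone in VPiece-in-A (psi g s z) sj≤k piece , inverse
  ... | inj₂ (m , m≤k , zone) =
    let (piece , inverse) = horizontal-backward zone in HPiece-in-A (psi g s z) m≤k piece , inverse

-- Lemma 4.6.
lemma4p6 : (g : ℕ → ℕ) → NonDecreasing g → Unbounded g →
    (gp : ℕ → ℕ) → IsGPlus g gp →
    (s : ℕ → ℕ) → IsStepPoints gp s →
    (k : ℕ) →
      (∀ x y → InA g s k (x , y) → InB g s k (phi g gp (x , y))) ×
      (∀ z → InB g s k z → InA g s k (psi g s z)) ×
      (∀ x y → InA g s k (x , y) → psi g s (phi g gp (x , y)) ≡ (x , y)) ×
      (∀ z → InB g s k z → phi g gp (psi g s z) ≡ z)
lemma4p6 g mono _ gp gp-least s steps k =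
  (λ x y xy∈A → proj₁ (phi-on-A k x y xy∈A)) ,
  (λ z z∈B → proj₁ (psi-on-B k z z∈B)) ,
  (λ x y xy∈A → proj₂ (phi-on-A k x y xy∈A)) ,
  (λ z z∈B → proj₂ (psi-on-B k z z∈B))
  where open StepPoints g mono gp gp-least s steps
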